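{- Let $I$ be a set. The full subcategory of the category $\mathrm{Mnd}(\mathbf{Set}^I)=\mathrm{Mon}(\mathrm{Endo}(\mathbf{Set}^I),\mathrm{Id},\circ)$ of monads on $\mathbf{Set}^I$ whose underlying endofunctors are extents of $I$-indexed containers is equivalent to the category $\mathbf{ICMS}$ of $I$-indexed containers equipped with an ICMS and ICMS morphisms.
   Context: $\mathbf{Set}^I$ is the category of $I$-indexed families of sets with families of functions as morphisms; $\mathrm{Hom}_I(X,Y)$ denotes its hom-sets. An indexed container $S\triangleleft P$ has $S:I\to\mathbf{Set}$ and $P_i(s):I\to\mathbf{Set}$ for $i\in I$, $s\in S_i$; its extent is the endofunctor $[\![S\triangleleft P]\!](X)_i=\sum_{s\in S_i}\mathrm{Hom}_I(P_i(s),X)$, acting on maps by postcomposition. Container morphisms $(\sigma,\pi):S\triangleleft P\to S'\triangleleft P'$ have $\sigma_i:S_i\to S'_i$ and $\pi_{i,s}\in\mathrm{Hom}_I(P'_i(\sigma_is),P_i(s))$. An ICMS on $S\triangleleft P$: $\mathsf{e}_i\in S_i$; $s\bullet_is'\in S_i$ for $s'\in\mathrm{Hom}_I(P_i(s),S)$; $P\mathsf{e}_{\equiv,i,j}:P_i(\mathsf{e}_i)(j)\to(i=j)$; for $p\in P_i(s\bullet s')(j)$: $\uparrow p\in I$, $\nwarrow p\in P_i(s)(\uparrow p)$, $\nearrow p\in P_{\uparrow p}(s'_{\uparrow p}(\nwarrow p))(j)$. With $\mathsf{e}^P_j(\_)=\mathsf{e}_j$, $\bar s_j(q)=s$ (transported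 along $P\mathsf{e}_{\equiv}(q)$), $(s'\bullet^Ps'')_k(q)=s'_k(q)\bullet_ks''_{k,q}$ (for $s''_{k,q}\in\mathrm{Hom}_I(P_k(s'_k q),S)$) and $\widehat{s''}_\ell(r)=(s''_{\uparrow r,\nwarrow r})_\ell(\nearrow r)$, required (heterogeneously, up to transport): $s\bullet\mathsf{e}^P=s$; $\nwarrow_{i,s,\mathsf{e}^P,j}p=p$; $\mathsf{e}_i\bullet\bar s=s$; $\nearrow_{i,\mathsf{e}_i,\bar s,j}p=p$; $(s\bullet s')\bullet\widehat{s''}=s\bullet(s'\bullet^Ps'')$; and for $p\in P_i((s\bullet s')\bullet\widehat{s''})(j)$, writing $\uparrow p,\nwarrow p,\nearrow p$ for $\uparrow_{i,s,s'\bullet^Ps'',j}p$ etc.: $\uparrow_{i,s\bullet s',\widehat{s''},j}p=\uparrow_{\uparrow p,s'(\nwarrow p),s''(\nwarrow p),j}(\nearrow p)$; $\uparrow_{i,s,s'}(\nwarrow_{i,s\bullet s',\widehat{s''},j}p)=\uparrow p$; $\nwarrow_{i,s,s'}(\nwarrow_{i,s\bullet s',\widehat{s''},j}p)=\nwarrow p$; $\nearrow_{i,s,s'}(\nwarrow_{i,s\bullet s',\widehat{s''},j}p)=\nwarrow_{\uparrow p,s'(\nwarrow p),s''(\nwarrow p),j}(\nearrow p)$; $\nearrow_{i,s\bullet s',\widehat{s''},j}p=\nearrow_{\uparrow p,s'(\nwarrow p),s''(\nwarrow p),j}(\nearrow p)$. An ICMS morphism is a container morphism $(\sigma,\pi)$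 with: $\sigma_i(\mathsf{e}_i)=\mathsf{e}'_i$; $P\mathsf{e}_{\equiv}(\pi_{i,\mathsf{e}_i}(q))=P\mathsf{e}'_{\equiv}(q)$; $\sigma_i(s)\bullet'(\pi_{i,s};v;\sigma)=\sigma_i(s\bullet v)$ (where $(\pi_{i,s};v;\sigma)_k(q)=\sigma_k(v_k(\pi_{i,s}q))$); and for $p\in P'_i(\sigma_i(s\bullet v))(j)$, with primed operations at $(i,\sigma_is,\pi_{i,s};v;\sigma,j)$: $\uparrow'p=\uparrow(\pi p)$, $\pi(\nwarrow'p)=\nwarrow(\pi p)$, $\pi(\nearrow'p)=\nearrow(\pi p)$. -}

module Defs where

open import Level using (Level; _⊔_; 0ℓ) renaming (suc to lsuc)
open import Data.Product using (Σ; _,_; proj₁; proj₂; _×_)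
open import Function using (_∘′_)
open import Relation.Binary.PropositionalEquality
  using (_≡_; refl; sym; trans; cong; subst)
open import Relation.Binary.HeterogeneousEquality as H using (_≅_)
open import Relation.Binary.Structures using (IsEquivalence)
open import Axiom.UniquenessOfIdentityProofs.WithK using (uip)

Hom : {I : Set} → (I → Set) → (I → Set) → Set
Hom {I} X Y = (i : I) → X i → Y i

record Container (I : Set) : Set₁ where
  constructor _◁_
  field
    Sh : I → Set
    Po : (i : I) → Sh i → I → Set

module _ {I : Set} where

  ⟦_⟧ : Container I → (I → Set) → (I → Set)
  ⟦ C ⟧ X i = Σ (Container.Sh C i) λ s → Hom (Container.Po C i s) X

  ⟦_⟧₁ : (C : Container I) {X Y : I → Set} → Hom X Y → Hom (⟦ C ⟧ X) (⟦ C ⟧ Y)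
  ⟦ C ⟧₁ f i x = proj₁ x , λ j p → f j (proj₂ x j p)

record Category (o ℓ e : Level) : Set (lsuc (o ⊔ ℓ ⊔ e)) where
  infix  4 _≈_
  infixr 9 _∘_
  field
    Obj : Set o
    _⇒_ : Obj → Obj → Set ℓ
    _≈_ : ∀ {A B} → (A ⇒ B) → (A ⇒ B) → Set e
    id  : ∀ {A} → A ⇒ A
    _∘_ : ∀ {A B C} → B ⇒ C → A ⇒ B → A ⇒ C
    assoc     : ∀ {A B C D} {f : A ⇒ B} {g : B ⇒ C} {h : C ⇒ D} →
                (h ∘ g) ∘ f ≈ h ∘ (g ∘ f)
    identityˡ : ∀ {A B} {f : A ⇒ B} → id ∘ f ≈ f
    identityʳ : ∀ {A B} {f : A ⇒ B} → f ∘ id ≈ f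
    equiv     : ∀ {A B} → IsEquivalence (_≈_ {A} {B})
    ∘-resp-≈  : ∀ {A B C} {f h : B ⇒ C} {g i : A ⇒ B} →
                f ≈ h → g ≈ i → f ∘ g ≈ h ∘ i

record Functor {o ℓ e o′ ℓ′ e′ : Level}
               (C : Category o ℓ e) (D : Category o′ ℓ′ e′)
               : Set (o ⊔ ℓ ⊔ e ⊔ o′ ⊔ ℓ′ ⊔ e′) where
  private
    module C = Category C
    module D = Category D
  field
    F₀ : C.Obj → D.Obj
    F₁ : ∀ {A B} → A C.⇒ B → F₀ A D.⇒ F₀ B
    identity     : ∀ {A} → F₁ (C.id {A}) D.≈ D.id
    homomorphism : ∀ {X Y Z} {f : X C.⇒ Y} {g : Y C.⇒ Z} →
                   F₁ (g C.∘ f) D.≈ F₁ g D.∘ F₁ f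
    F-resp-≈     : ∀ {A B} {f g : A C.⇒ B} → f C.≈ g → F₁ f D.≈ F₁ g

idF : ∀ {o ℓ e} {C : Category o ℓ e} → Functor C C
idF {C = C} = record
  { F₀ = λ A → A ; F₁ = λ f → f
  ; identity = IsEquivalence.refl equiv
  ; homomorphism = IsEquivalence.refl equiv
  ; F-resp-≈ = λ p → p }
  where open Category C

_∘F_ : ∀ {o ℓ e o′ ℓ′ e′ o″ ℓ″ e″}
         {C : Category o ℓ e} {D : Category o′ ℓ′ e′} {E : Category o″ ℓ″ e″} →
       Functor D E → Functor C D → Functor C E
_∘F_ {E = E} G F = record
  { F₀ = λ A → G.F₀ (F.F₀ A)
  ; F₁ = λ f → G.F₁ (F.F₁ f)
  ; identity = IsEquivalence.trans E.equiv (G.F-resp-≈ F.identity) G.identity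
  ; homomorphism = IsEquivalence.trans E.equiv (G.F-resp-≈ F.homomorphism) G.homomorphism
  ; F-resp-≈ = λ p → G.F-resp-≈ (F.F-resp-≈ p) }
  where
    module G = Functor G
    module F = Functor F
    module E = Category E

record NaturalIsomorphism {o ℓ e o′ ℓ′ e′ : Level}
                          {C : Category o ℓ e} {D : Category o′ ℓ′ e′}
                          (F G : Functor C D) : Set (o ⊔ ℓ ⊔ ℓ′ ⊔ e′) where
  private
    module C = Category C
    module D = Category D
    module F = Functor F
    module G = Functor G
  field
    ⇒η  : ∀ X → F.F₀ X D.⇒ G.F₀ X
    ⇐η  : ∀ X → G.F₀ X D.⇒ F.F₀ X
    commute : ∀ {X Y} (f : X C.⇒ Y) → ⇒η Y D.∘ F.F₁ f D.≈ G.F₁ f D.∘ ⇒η X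
    isoˡ : ∀ X → ⇐η X D.∘ ⇒η X D.≈ D.id
    isoʳ : ∀ X → ⇒η X D.∘ ⇐η X D.≈ D.id

record Equivalence {o ℓ e o′ ℓ′ e′ : Level}
                   (C : Category o ℓ e) (D : Category o′ ℓ′ e′)
                   : Set (o ⊔ ℓ ⊔ e ⊔ o′ ⊔ ℓ′ ⊔ e′) where
  field
    F : Functor C D
    G : Functor D C
    unit   : NaturalIsomorphism (idF {C = C}) (G ∘F F)
    counit : NaturalIsomorphism (F ∘F G) (idF {C = D})

module _ {I : Set} where

  record ICMSOps (C : Container I) : Set where
    open Container C renaming (Sh to S; Po to P)
    infixl 7 _•_
    field
      e   : (i : I) → S i
      _•_ : ∀ {i} (s : S i) → Hom (P i s) S → S i
      Pe≡ : ∀ {i j} → P i (e i) j → i ≡ j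
      ↑   : (i : I) (s : S i) (s' : Hom (P i s) S) (j : I) → P i (s • s') j → I
      ↖   : (i : I) (s : S i) (s' : Hom (P i s) S) (j : I) (p : P i (s • s') j) →
            P i s (↑ i s s' j p)
      ↗   : (i : I) (s : S i) (s' : Hom (P i s) S) (j : I) (p : P i (s • s') j) →
            P (↑ i s s' j p) (s' (↑ i s s' j p) (↖ i s s' j p)) j

    eᴾ : ∀ {i} (s : S i) → Hom (P i s) S
    eᴾ s j _ = e j

    bar : ∀ {i} (s : S i) → Hom (P i (e i)) S
    bar s j q = subst S (Pe≡ q) s

    _•ᴾ_ : ∀ {i} {s : S i} (s' : Hom (P i s) S)
           (s'' : (k : I) (q : P i s k) → Hom (P k (s' k q)) S) → Hom (P i s) S
    (s' •ᴾ s'') k q = s' k q • s'' k q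

    hat : ∀ {i} (s : S i) (s' : Hom (P i s) S)
          (s'' : (k : I) (q : P i s k) → Hom (P k (s' k q)) S) →
          Hom (P i (s • s')) S
    hat {i} s s' s'' ℓ r = s'' (↑ i s s' ℓ r) (↖ i s s' ℓ r) ℓ (↗ i s s' ℓ r)

  record ICMSLaws {C : Container I} (O : ICMSOps C) : Set where
    open Container C renaming (Sh to S; Po to P)
    open ICMSOps O
    field
      •-unitʳ : ∀ i (s : S i) → s • eᴾ s ≡ s
      ↖-unitʳ : ∀ i (s : S i) j (p : P i (s • eᴾ s) j) → ↖ i s (eᴾ s) j p ≅ p
      •-unitˡ : ∀ i (s : S i) → e i • bar s ≡ s
      ↗-unitˡ : ∀ i (s : S i) j (p : P i (e i • bar s) j) → ↗ i (e i) (bar s) j p ≅ p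
      •-assoc : ∀ i (s : S i) (s' : Hom (P i s) S)
                (s'' : (k : I) (q : P i s k) → Hom (P k (s' k q)) S) →
                (s • s') • hat s s' s'' ≡ s • (s' •ᴾ s'')
      ↑-assoc₁ : ∀ i (s : S i) (s' : Hom (P i s) S)
                 (s'' : (k : I) (q : P i s k) → Hom (P k (s' k q)) S)
                 j (p : P i ((s • s') • hat s s' s'') j) →
        let p₀ = subst (λ t → P i t j) (•-assoc i s s' s'') p
            a  = ↑ i s (s' •ᴾ s'') j p₀
            b  = ↖ i s (s' •ᴾ s'') j p₀
            c  = ↗ i s (s' •ᴾ s'') j p₀
        in ↑ i (s • s') (hat s s' s'') j p ≡ ↑ a (s' a b) (s'' a b) j c
      ↑-assoc₂ : ∀ i (s : S i) (s' : Hom (P i s) S)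
                 (s'' : (k : I) (q : P i s k) → Hom (P k (s' k q)) S)
                 j (p : P i ((s • s') • hat s s' s'') j) →
        let p₀ = subst (λ t → P i t j) (•-assoc i s s' s'') p
            a  = ↑ i s (s' •ᴾ s'') j p₀
        in ↑ i s s' (↑ i (s • s') (hat s s' s'') j p)
                    (↖ i (s • s') (hat s s' s'') j p) ≡ a
      ↖-assoc : ∀ i (s : S i) (s' : Hom (P i s) S)
                (s'' : (k : I) (q : P i s k) → Hom (P k (s' k q)) S)
                j (p : P i ((s • s') • hat s s' s'') j) →
        let p₀ = subst (λ t → P i t j) (•-assoc i s s' s'') p
            b  = ↖ i s (s' •ᴾ s'') j p₀
        in ↖ i s s' (↑ i (s • s') (hat s s' s'') j p)
                    (↖ i (s • s') (hat s s' s'') j p) ≅ b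
      ↗↖-assoc : ∀ i (s : S i) (s' : Hom (P i s) S)
                 (s'' : (k : I) (q : P i s k) → Hom (P k (s' k q)) S)
                 j (p : P i ((s • s') • hat s s' s'') j) →
        let p₀ = subst (λ t → P i t j) (•-assoc i s s' s'') p
            a  = ↑ i s (s' •ᴾ s'') j p₀
            b  = ↖ i s (s' •ᴾ s'') j p₀
            c  = ↗ i s (s' •ᴾ s'') j p₀
        in ↗ i s s' (↑ i (s • s') (hat s s' s'') j p)
                    (↖ i (s • s') (hat s s' s'') j p) ≅ ↖ a (s' a b) (s'' a b) j c
      ↗-assoc : ∀ i (s : S i) (s' : Hom (P i s) S)
                (s'' : (k : I) (q : P i s k) → Hom (P k (s' k q)) S)
                j (p : P i ((s • s') • hat s s' s'') j) →
        let p₀ = subst (λ t → P i t j) (•-assoc i s s' s'') p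
            a  = ↑ i s (s' •ᴾ s'') j p₀
            b  = ↖ i s (s' •ᴾ s'') j p₀
            c  = ↗ i s (s' •ᴾ s'') j p₀
        in ↗ i (s • s') (hat s s' s'') j p ≅ ↗ a (s' a b) (s'' a b) j c

  record ICMS (C : Container I) : Set where
    field
      ops  : ICMSOps C
      laws : ICMSLaws ops
    open ICMSOps ops public
    open ICMSLaws laws public

  record ICMSObj : Set₁ where
    constructor _,ᵢ_
    field
      cont : Container I
      icms : ICMS cont

  ⟨_,_⟩_⨾_⨾_ : (C C' : Container I) {i : I} {s : Container.Sh C i} {s' : Container.Sh C' i} →
          Hom (Container.Po C' i s') (Container.Po C i s) →
          Hom (Container.Po C i s) (Container.Sh C) →
          ((k : I) → Container.Sh C k → Container.Sh C' k) →
          Hom (Container.Po C' i s') (Container.Sh C')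
  (⟨ C , C' ⟩ π ⨾ v ⨾ σ) k q = σ k (v k (π k q))

  record ICMSMor (A B : ICMSObj) : Set where
    open ICMSObj A renaming (cont to C; icms to M)
    open ICMSObj B renaming (cont to C'; icms to M')
    open Container C renaming (Sh to S; Po to P)
    open Container C' renaming (Sh to S'; Po to P')
    open ICMS M
    open ICMS M' renaming (e to e'; _•_ to _•'_; Pe≡ to Pe≡'; ↑ to ↑'; ↖ to ↖'; ↗ to ↗')
      using ()
    field
      σ : (i : I) → S i → S' i
      π : (i : I) (s : S i) → Hom (P' i (σ i s)) (P i s)
      σ-e : ∀ i → σ i (e i) ≡ e' i
      π-e : ∀ i j (q : P' i (σ i (e i)) j) →
            Pe≡ (π i (e i) j q) ≡ Pe≡' (subst (λ t → P' i t j) (σ-e i) q)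
      σ-• : ∀ i (s : S i) (v : Hom (P i s) S) →
            σ i s •' (⟨ C , C' ⟩ π i s ⨾ v ⨾ σ) ≡ σ i (s • v)
      π-↑ : ∀ i (s : S i) (v : Hom (P i s) S) j (p : P' i (σ i (s • v)) j) →
            let p' = subst (λ t → P' i t j) (sym (σ-• i s v)) p
            in ↑' i (σ i s) (⟨ C , C' ⟩ π i s ⨾ v ⨾ σ) j p' ≡ ↑ i s v j (π i (s • v) j p)
      π-↖ : ∀ i (s : S i) (v : Hom (P i s) S) j (p : P' i (σ i (s • v)) j) →
            let p' = subst (λ t → P' i t j) (sym (σ-• i s v)) p
            in π i s (↑' i (σ i s) (⟨ C , C' ⟩ π i s ⨾ v ⨾ σ) j p') (↖' i (σ i s) (⟨ C , C' ⟩ π i s ⨾ v ⨾ σ) j p')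
               ≅ ↖ i s v j (π i (s • v) j p)
      π-↗ : ∀ i (s : S i) (v : Hom (P i s) S) j (p : P' i (σ i (s • v)) j) →
            let p' = subst (λ t → P' i t j) (sym (σ-• i s v)) p
                k  = ↑' i (σ i s) (⟨ C , C' ⟩ π i s ⨾ v ⨾ σ) j p'
                q  = ↖' i (σ i s) (⟨ C , C' ⟩ π i s ⨾ v ⨾ σ) j p'
            in π k (v k (π i s k q)) j (↗' i (σ i s) (⟨ C , C' ⟩ π i s ⨾ v ⨾ σ) j p')
               ≅ ↗ i s v j (π i (s • v) j p)

private
  hcong₂ : {A : Set} {B : A → Set} {C : (a : A) → B a → Set}
           (f : (a : A) (b : B a) → C a b) {a a' : A} {b : B a} {b' : B a'} →
           a ≡ a' → b ≅ b' → f a b ≅ f a' b'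
  hcong₂ f refl H.refl = H.refl

  hcong₃ : {A : Set} {B : A → Set} {C : (a : A) → B a → Set}
           {D : (a : A) (b : B a) → C a b → Set}
           (f : (a : A) (b : B a) (c : C a b) → D a b c)
           {a a' : A} {b : B a} {b' : B a'} {c : C a b} {c' : C a' b'} →
           a ≡ a' → b ≅ b' → c ≅ c' → f a b c ≅ f a' b' c'
  hcong₃ f refl H.refl H.refl = H.refl

module _ {I : Set} where

  open ICMSObj

  _≈ᵢ_ : {A B : ICMSObj {I}} → ICMSMor A B → ICMSMor A B → Set
  _≈ᵢ_ {A} {B} f g =
    (∀ i s → ICMSMor.σ f i s ≡ ICMSMor.σ g i s) ×
    (∀ i s j (q : Container.Po (cont B) i (ICMSMor.σ f i s) j)
             (q' : Container.Po (cont B) i (ICMSMor.σ g i s) j) →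
       q ≅ q' → ICMSMor.π f i s j q ≡ ICMSMor.π g i s j q')

  idᵢ : {A : ICMSObj {I}} → ICMSMor A A
  idᵢ = record
    { σ = λ i s → s ; π = λ i s j q → q
    ; σ-e = λ i → refl ; π-e = λ i j q → refl ; σ-• = λ i s v → refl
    ; π-↑ = λ i s v j p → refl ; π-↖ = λ i s v j p → H.refl
    ; π-↗ = λ i s v j p → H.refl }

  module _ {A B : ICMSObj {I}} (f : ICMSMor A B) where
    private
      open Container (cont A) renaming (Sh to S; Po to P)
      open Container (cont B) renaming (Sh to S'; Po to P')
      module M = ICMS (icms A)
      module M' = ICMS (icms B)
      open ICMSMor f
    lawsH : ∀ i (s : S i) (v : Hom (P i s) S) j
            (p' : P' i (σ i s M'.• (⟨ cont A , cont B ⟩ π i s ⨾ v ⨾ σ)) j)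
            (p : P' i (σ i (s M.• v)) j) → p' ≅ p →
            let vv = ⟨ cont A , cont B ⟩ π i s ⨾ v ⨾ σ
                k  = M'.↑ i (σ i s) vv j p'
                q  = M'.↖ i (σ i s) vv j p'
            in (k ≡ M.↑ i s v j (π i (s M.• v) j p)) ×
               (π i s k q ≅ M.↖ i s v j (π i (s M.• v) j p)) ×
               (π k (v k (π i s k q)) j (M'.↗ i (σ i s) vv j p')
                  ≅ M.↗ i s v j (π i (s M.• v) j p))
    lawsH i s v j p' p h
      with H.≅-to-≡ (H.trans h (H.sym (H.≡-subst-removable (λ t → P' i t j) (sym (σ-• i s v)) p)))
    ... | refl = π-↑ i s v j p , π-↖ i s v j p , π-↗ i s v j p

  _∘ᵢ_ : {A B D : ICMSObj {I}} → ICMSMor B D → ICMSMor A B → ICMSMor A D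
  _∘ᵢ_ {A} {B} {D} g f = record
    { σ = λ i s → σg i (σf i s)
    ; π = λ i s j q → πf i s j (πg i (σf i s) j q)
    ; σ-e = λ i → trans (cong (σg i) (σf-e i)) (σg-e i)
    ; π-e = λ i j q → uip _ _
    ; σ-• = σ-•c
    ; π-↑ = λ i s v j p → proj₁ (main i s v j p)
    ; π-↖ = λ i s v j p → proj₁ (proj₂ (main i s v j p))
    ; π-↗ = λ i s v j p → proj₂ (proj₂ (main i s v j p)) }
    where
      open Container (cont A) renaming (Sh to S₁; Po to P₁)
      open Container (cont B) renaming (Sh to S₂; Po to P₂)
      open Container (cont D) renaming (Sh to S₃; Po to P₃)
      module M₁ = ICMS (icms A)
      module M₂ = ICMS (icms B)
      module M₃ = ICMS (icms D)
      open ICMSMor f renaming (σ to σf; π to πf; σ-e to σf-e; σ-• to σf-•)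
      open ICMSMor g renaming (σ to σg; π to πg; σ-e to σg-e; σ-• to σg-•)
      σ-•c : ∀ i (s : S₁ i) (v : Hom (P₁ i s) S₁) →
             σg i (σf i s) M₃.• (λ k q → σg k (σf k (v k (πf i s k (πg i (σf i s) k q)))))
             ≡ σg i (σf i (s M₁.• v))
      σ-•c i s v = trans (σg-• i (σf i s) (⟨ cont A , cont B ⟩ πf i s ⨾ v ⨾ σf))
                         (cong (σg i) (σf-• i s v))
      main : ∀ i (s : S₁ i) (v : Hom (P₁ i s) S₁) j (p : P₃ i (σg i (σf i (s M₁.• v))) j) →
             let vv = λ k q → σg k (σf k (v k (πf i s k (πg i (σf i s) k q))))
                 p~ = subst (λ t → P₃ i t j) (sym (σ-•c i s v)) p
                 k  = M₃.↑ i (σg i (σf i s)) vv j p~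
                 q  = M₃.↖ i (σg i (σf i s)) vv j p~
                 π  = λ i s j q → πf i s j (πg i (σf i s) j q)
             in (k ≡ M₁.↑ i s v j (π i (s M₁.• v) j p)) ×
                (π i s k q ≅ M₁.↖ i s v j (π i (s M₁.• v) j p)) ×
                (π k (v k (π i s k q)) j (M₃.↗ i (σg i (σf i s)) vv j p~)
                   ≅ M₁.↗ i s v j (π i (s M₁.• v) j p))
      main i s v j p = trans G1 F1 , H.trans c2 F2 , H.trans c3 F3
        where
          vf = ⟨ cont A , cont B ⟩ πf i s ⨾ v ⨾ σf
          ef = σf-• i s v
          q  = subst (λ t → P₃ i (σg i t) j) (sym ef) p
          p~ = subst (λ t → P₃ i t j) (sym (σ-•c i s v)) p
          hq : q ≅ p
          hq = H.≡-subst-removable (λ t → P₃ i (σg i t) j) (sym ef) p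
          h1 : p~ ≅ q
          h1 = H.trans (H.≡-subst-removable (λ t → P₃ i t j) (sym (σ-•c i s v)) p) (H.sym hq)
          Gs = lawsH g i (σf i s) vf j p~ q h1
          G1 = proj₁ Gs
          G2 = proj₁ (proj₂ Gs)
          G3 = proj₂ (proj₂ Gs)
          h2 : πg i (σf i s M₂.• vf) j q ≅ πg i (σf i (s M₁.• v)) j p
          h2 = hcong₂ (λ t x → πg i t j x) ef hq
          Fs = lawsH f i s v j (πg i (σf i s M₂.• vf) j q) (πg i (σf i (s M₁.• v)) j p) h2
          F1 = proj₁ Fs
          F2 = proj₁ (proj₂ Fs)
          F3 = proj₂ (proj₂ Fs)
          c2 = hcong₂ (λ k x → πf i s k x) G1 G2
          c3 = hcong₃ (λ k t x → πf k t j x) G1 (hcong₂ (λ k y → v k y) G1 c2) G3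

  ≈refl : {A B : ICMSObj {I}} (f : ICMSMor A B) → f ≈ᵢ f
  ≈refl f = (λ i s → refl) , λ i s j q q' h → cong (ICMSMor.π f i s j) (H.≅-to-≡ h)

  ≈sym : {A B : ICMSObj {I}} {f g : ICMSMor A B} → f ≈ᵢ g → g ≈ᵢ f
  ≈sym (e₁ , e₂) = (λ i s → sym (e₁ i s)) , λ i s j q q' h → sym (e₂ i s j q' q (H.sym h))

  ≈trans : {A B : ICMSObj {I}} {f g h : ICMSMor A B} → f ≈ᵢ g → g ≈ᵢ h → f ≈ᵢ h
  ≈trans {A} {B} {f} {g} {h} (e₁ , e₂) (e₃ , e₄) =
    (λ i s → trans (e₁ i s) (e₃ i s)) ,
    λ i s j q q'' hh →
      let q' = subst (λ t → Container.Po (cont B) i t j) (e₁ i s) q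
          hq = H.≡-subst-removable (λ t → Container.Po (cont B) i t j) (e₁ i s) q
      in trans (e₂ i s j q q' (H.sym hq)) (e₄ i s j q' q'' (H.trans hq hh))

  ICMS-Cat : Category (lsuc 0ℓ) 0ℓ 0ℓ
  ICMS-Cat = record
    { Obj = ICMSObj {I}
    ; _⇒_ = ICMSMor
    ; _≈_ = _≈ᵢ_
    ; id  = idᵢ
    ; _∘_ = _∘ᵢ_
    ; assoc = λ {_} {_} {_} {_} {f} {g} {h} → ≈refl (h ∘ᵢ (g ∘ᵢ f))
    ; identityˡ = λ {_} {_} {f} → ≈refl f
    ; identityʳ = λ {_} {_} {f} → ≈refl f
    ; equiv = λ {A} {B} → record
      { refl  = λ {f} → ≈refl f
      ; sym   = λ {f} {g} → ≈sym {A} {B} {f} {g}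
      ; trans = λ {f} {g} {h} → ≈trans {A} {B} {f} {g} {h} }
    ; ∘-resp-≈ = λ {A} {B} {C} {f} {h} {g} {i} → resp {A} {B} {C} {f} {h} {g} {i} }
    where
      resp : {A B C : ICMSObj} {f h : ICMSMor B C} {g i : ICMSMor A B} →
             f ≈ᵢ h → g ≈ᵢ i → (f ∘ᵢ g) ≈ᵢ (h ∘ᵢ i)
      resp {A} {B} {C} {f} {h} {g} {i} (e₁ , e₂) (e₃ , e₄) =
        (λ k s → trans (cong (ICMSMor.σ f k) (e₃ k s)) (e₁ k (ICMSMor.σ i k s))) ,
        λ k s j q q' hh → e₄ k s j (ICMSMor.π f k (ICMSMor.σ g k s) j q)
                                   (ICMSMor.π h k (ICMSMor.σ i k s) j q') (L (e₃ k s) q q' hh)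
        where
          L : ∀ {k j t t'} → t ≡ t' →
              (q : Container.Po (cont C) k (ICMSMor.σ f k t) j)
              (q' : Container.Po (cont C) k (ICMSMor.σ h k t') j) → q ≅ q' →
              ICMSMor.π f k t j q ≅ ICMSMor.π h k t' j q'
          L {k} {j} {t} refl q q' hh = H.≡-to-≅ (e₂ k t j q q' hh)

-- Monads on Set^I whose underlying endofunctor is the extent ⟦ C ⟧ of an
-- indexed container C (objects of the full subcategory of Mnd(Set^I)),
-- and monad morphisms between them (all natural transformations
-- compatible with unit and multiplication).

module _ {I : Set} where

  record ContainerMonad : Set₁ where
    field
      cont : Container I
    T = ⟦ cont ⟧
    T₁ = ⟦ cont ⟧₁
    field
      η : (X : I → Set) → Hom X (T X)
      μ : (X : I → Set) → Hom (T (T X)) (T X)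
      η-natural : ∀ {X Y} (f : Hom X Y) i (x : X i) →
                  η Y i (f i x) ≡ T₁ f i (η X i x)
      μ-natural : ∀ {X Y} (f : Hom X Y) i (x : T (T X) i) →
                  μ Y i (T₁ (T₁ f) i x) ≡ T₁ f i (μ X i x)
      unitˡ : ∀ X i (x : T X i) → μ X i (η (T X) i x) ≡ x
      unitʳ : ∀ X i (x : T X i) → μ X i (T₁ (η X) i x) ≡ x
      assoc : ∀ X i (x : T (T (T X)) i) →
              μ X i (μ (T X) i x) ≡ μ X i (T₁ (μ X) i x)

  record MonadMor (M N : ContainerMonad) : Set₁ where
    private
      module M = ContainerMonad M
      module N = ContainerMonad N
    field
      α : (X : I → Set) → Hom (M.T X) (N.T X)
      α-natural : ∀ {X Y} (f : Hom X Y) i (x : M.T X i) →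
                  α Y i (M.T₁ f i x) ≡ N.T₁ f i (α X i x)
      α-η : ∀ X i (x : X i) → α X i (M.η X i x) ≡ N.η X i x
      α-μ : ∀ X i (x : M.T (M.T X) i) →
            N.μ X i (α (N.T X) i (M.T₁ (α X) i x)) ≡ α X i (M.μ X i x)

  _≈ₘ_ : {M N : ContainerMonad} → MonadMor M N → MonadMor M N → Set₁
  f ≈ₘ g = ∀ X i x → MonadMor.α f X i x ≡ MonadMor.α g X i x

  idₘ : {M : ContainerMonad} → MonadMor M M
  idₘ = record { α = λ X i x → x ; α-natural = λ f i x → refl
               ; α-η = λ X i x → refl ; α-μ = λ X i x → refl }

  _∘ₘ_ : {L M N : ContainerMonad} → MonadMor M N → MonadMor L M → MonadMor L N
  _∘ₘ_ {L} {M} {N} g f = record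
    { α = λ X i x → αg X i (αf X i x)
    ; α-natural = λ h i x → trans (cong (αg _ i) (αf-nat h i x)) (αg-nat h i (αf _ i x))
    ; α-η = λ X i x → trans (cong (αg X i) (αf-η X i x)) (αg-η X i x)
    ; α-μ = λ X i x →
        trans (cong (λ y → N.μ X i (αg (N.T X) i y)) (αf-nat (αg X) i (L.T₁ (αf X) i x)))
        (trans (αg-μ X i (αf (M.T X) i (L.T₁ (αf X) i x)))
               (cong (αg X i) (αf-μ X i x))) }
    where
      module L = ContainerMonad L
      module M = ContainerMonad M
      module N = ContainerMonad N
      open MonadMor f renaming (α to αf; α-natural to αf-nat; α-η to αf-η; α-μ to αf-μ)
      open MonadMor g renaming (α to αg; α-natural to αg-nat; α-η to αg-η; α-μ to αg-μ)

  Mnd-Cat : Category (lsuc 0ℓ) (lsuc 0ℓ) (lsuc 0ℓ)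
  Mnd-Cat = record
    { Obj = ContainerMonad
    ; _⇒_ = MonadMor
    ; _≈_ = _≈ₘ_
    ; id = idₘ
    ; _∘_ = _∘ₘ_
    ; assoc = λ X i x → refl
    ; identityˡ = λ X i x → refl
    ; identityʳ = λ X i x → refl
    ; equiv = record { refl = λ X i x → refl
                     ; sym = λ p X i x → sym (p X i x)
                     ; trans = λ p q X i x → trans (p X i x) (q X i x) }
    ; ∘-resp-≈ = λ {_} {_} {_} {f} {h} {g} {i} p q X j x →
        trans (cong (MonadMor.α f X j) (q X j x)) (p X j (MonadMor.α i X j x)) }

-- By naturality, a monad structure on ⟦ S ◁ P ⟧ is determined by its values on generic elements
-- (Yoneda): the unit at the representable family i ≡_ gives e and Pe≡, and the multiplication at
-- the generic element of ⟦ S ◁ P ⟧ (⟦ S ◁ P ⟧ (positions of s • s')) gives •, ↑, ↖ and ↗.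
-- Conversely these operations define a natural unit and multiplication, and each monad law holds
-- as soon as it holds at a generic element, where it says exactly that two shapes agree and that
-- corresponding positions agree: these are the ICMS laws. In the same way a natural transformation
-- between extents is a container morphism (σ, π), and it preserves unit and multiplication exactly
-- when (σ, π) is an ICMS morphism. Both round trips are then the identity on carriers.

{-# OPTIONS --safe #-}
module Submission where

open import Defs
open import Level using (0ℓ)
open import Axiom.Extensionality.Propositional using (Extensionality)
open import Axiom.UniquenessOfIdentityProofs.WithK using (uip)
open import Data.Product using (Σ; _,_; proj₁; proj₂; _×_)
open import Relation.Binary.PropositionalEquality
  using (_≡_; refl; sym; trans; cong; subst; module ≡-Reasoning)
open import Relation.Binary.PropositionalEquality.Properties using (subst-application′)
open import Relation.Binary.HeterogeneousEquality as H using (_≅_; module ≅-Reasoning)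

module _ {I : Set} (ext : Extensionality 0ℓ 0ℓ) where

  module Extent (C : Container I) where
    open Container C renaming (Sh to S; Po to P)

    generic : ∀ {i} (s : S i) → ⟦ C ⟧ (P i s) i
    generic s = s , λ _ p → p

    Positions² : (i : I) (s : S i) → Hom (P i s) S → I → Set
    Positions² i s s' j = Σ I λ k → Σ (P i s k) λ q → P k (s' k q) j

    generic² : ∀ {i} (s : S i) (s' : Hom (P i s) S) → ⟦ C ⟧ (⟦ C ⟧ (Positions² i s s')) i
    generic² s s' = s , λ k q → s' k q , λ j r → k , q , r

    ⟦⟧-≡ : ∀ {X i} {x y : ⟦ C ⟧ X i} (eq : proj₁ x ≡ proj₁ y) →
           (∀ j p → proj₂ x j p ≡ proj₂ y j (subst (λ t → P i t j) eq p)) → x ≡ y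
    ⟦⟧-≡ {x = s , f} refl agree = cong (s ,_) (ext λ j → ext (agree j))

    ⟦⟧-≡-positions : ∀ {X i} {x y : ⟦ C ⟧ X i} → x ≡ y → (eq : proj₁ x ≡ proj₁ y) →
                     ∀ j p → proj₂ x j p ≡ proj₂ y j (subst (λ t → P i t j) eq p)
    ⟦⟧-≡-positions refl refl j p = refl

    ⟦⟧-≡-positions-≅ : ∀ {X i} {x y : ⟦ C ⟧ X i} → x ≡ y →
                       ∀ j p q → p ≅ q → proj₂ x j p ≡ proj₂ y j q
    ⟦⟧-≡-positions-≅ refl j p .p H.refl = refl

    ⟦⟧₁-cong : ∀ {X Y} {f g : Hom X Y} → (∀ j y → f j y ≡ g j y) →
               ∀ {i} (x : ⟦ C ⟧ X i) → ⟦ C ⟧₁ f i x ≡ ⟦ C ⟧₁ g i x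
    ⟦⟧₁-cong f≗g (s , h) = cong (s ,_) (ext λ j → ext λ p → f≗g j (h j p))

    proj₂-subst-generic : ∀ {i k} (eq : i ≡ k) (s : S i) j
                          (r : P k (proj₁ (subst (⟦ C ⟧ (P i s)) eq (generic s))) j) →
                          proj₂ (subst (⟦ C ⟧ (P i s)) eq (generic s)) j r ≅ r
    proj₂-subst-generic refl s j r = H.refl

    Natural : ((X : I → Set) → Hom (⟦ C ⟧ X) (⟦ C ⟧ X)) → Set₁
    Natural α = ∀ {X Y} (f : Hom X Y) i x → α Y i (⟦ C ⟧₁ f i x) ≡ ⟦ C ⟧₁ f i (α X i x)

    natural-≡-id : (α : (X : I → Set) → Hom (⟦ C ⟧ X) (⟦ C ⟧ X)) → Natural α →
                   (∀ i s → α (P i s) i (generic s) ≡ generic s) → ∀ X i x → α X i x ≡ x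
    natural-≡-id α natural fixes X i (s , f) = begin
      α X i (⟦ C ⟧₁ f i (generic s))        ≡⟨ natural f i (generic s) ⟩
      ⟦ C ⟧₁ f i (α (P i s) i (generic s))  ≡⟨ cong (⟦ C ⟧₁ f i) (fixes i s) ⟩
      ⟦ C ⟧₁ f i (generic s)                ∎
      where open ≡-Reasoning

    positions²-≡ : ∀ {i s s' j} {k k' : I} {q : P i s k} {q' : P i s k'}
                   {r : P k (s' k q) j} {r' : P k' (s' k' q') j} →
                   k ≡ k' → q ≅ q' → r ≅ r' →
                   _≡_ {A = Positions² i s s' j} (k , q , r) (k' , q' , r')
    positions²-≡ refl H.refl H.refl = refl

    positions²-injective : ∀ {i s s' j} {k k' : I} {q : P i s k} {q' : P i s k'}
                           {r : P k (s' k q) j} {r' : P k' (s' k' q') j} →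
                           _≡_ {A = Positions² i s s' j} (k , q , r) (k' , q' , r') →
                           k ≡ k' × q ≅ q' × r ≅ r'
    positions²-injective refl = refl , H.refl , H.refl

    Positions³ : (i : I) (s : S i) (s' : Hom (P i s) S) →
                 ((k : I) (q : P i s k) → Hom (P k (s' k q)) S) → I → Set
    Positions³ i s s' s'' j =
      Σ I λ k → Σ (P i s k) λ q → Σ I λ l → Σ (P k (s' k q) l) λ r → P l (s'' k q l r) j

    generic³ : ∀ {i} (s : S i) (s' : Hom (P i s) S)
               (s'' : (k : I) (q : P i s k) → Hom (P k (s' k q)) S) →
               ⟦ C ⟧ (⟦ C ⟧ (⟦ C ⟧ (Positions³ i s s' s''))) i
    generic³ s s' s'' = s , λ k q → s' k q , λ l r → s'' k q l r , λ j t → k , q , l , r , t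

    positions³-≡ : ∀ {i s s' s'' j} {k k' l l' : I} {q : P i s k} {q' : P i s k'}
                   {r : P k (s' k q) l} {r' : P k' (s' k' q') l'}
                   {t : P l (s'' k q l r) j} {t' : P l' (s'' k' q' l' r') j} →
                   k ≡ k' → q ≅ q' → l ≡ l' → r ≅ r' → t ≅ t' →
                   _≡_ {A = Positions³ i s s' s'' j} (k , q , l , r , t) (k' , q' , l' , r' , t')
    positions³-≡ refl H.refl refl H.refl H.refl = refl

    positions³-injective : ∀ {i s s' s'' j} {k k' l l' : I} {q : P i s k} {q' : P i s k'}
                           {r : P k (s' k q) l} {r' : P k' (s' k' q') l'}
                           {t : P l (s'' k q l r) j} {t' : P l' (s'' k' q' l' r') j} →
                           _≡_ {A = Positions³ i s s' s'' j} (k , q , l , r , t) (k' , q' , l' , r' , t') →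
                           k ≡ k' × q ≅ q' × l ≡ l' × r ≅ r' × t ≅ t'
    positions³-injective refl = refl , H.refl , refl , H.refl , H.refl

  module Canonical {C : Container I} (O : ICMSOps C) where
    open Container C renaming (Sh to S; Po to P)
    open ICMSOps O
    open Extent C

    T : (I → Set) → I → Set
    T = ⟦ C ⟧

    T₁ : ∀ {X Y} → Hom X Y → Hom (T X) (T Y)
    T₁ = ⟦ C ⟧₁

    η : (X : I → Set) → Hom X (T X)
    η X i x = e i , λ j q → subst X (Pe≡ q) x

    μ : (X : I → Set) → Hom (T (T X)) (T X)
    μ X i (s , f) = s • s' , λ j p → proj₂ (f (↑ i s s' j p) (↖ i s s' j p)) j (↗ i s s' j p)
      where
        s' : Hom (P i s) S
        s' k q = proj₁ (f k q)

    η-natural : ∀ {X Y} (f : Hom X Y) i (x : X i) → η Y i (f i x) ≡ T₁ f i (η X i x)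
    η-natural {X} f i x = cong (e i ,_) (ext λ j → ext λ q → subst-application′ X f (Pe≡ q))

    UnitˡLaw UnitʳLaw AssocLaw : Set₁
    UnitˡLaw = ∀ X i (x : T X i) → μ X i (η (T X) i x) ≡ x
    UnitʳLaw = ∀ X i (x : T X i) → μ X i (T₁ (η X) i x) ≡ x
    AssocLaw = ∀ X i (x : T (T (T X)) i) → μ X i (μ (T X) i x) ≡ μ X i (T₁ (μ X) i x)

    η-shapes : ∀ {i} (s : S i) → Hom (P i (e i)) S
    η-shapes {i} s k q = proj₁ (subst (T (P i s)) (Pe≡ q) (generic s))

    η-shapes≡bar : ∀ {i} (s : S i) → η-shapes s ≡ bar s
    η-shapes≡bar {i} s =
      ext λ k → ext λ q → sym (subst-application′ (T (P i s)) (λ _ → proj₁) (Pe≡ q))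

    ↗-cong : ∀ {i j} {s : S i} {s₁ s₂ : Hom (P i s) S} → s₁ ≡ s₂ →
             {p₁ : P i (s • s₁) j} {p₂ : P i (s • s₂) j} → p₁ ≅ p₂ →
             ↗ i s s₁ j p₁ ≅ ↗ i s s₂ j p₂
    ↗-cong refl H.refl = H.refl

  module ICMSLawsFromMonadLaws {C : Container I} (O : ICMSOps C)
    (unitˡ : Canonical.UnitˡLaw O) (unitʳ : Canonical.UnitʳLaw O) (assoc : Canonical.AssocLaw O)
    where
    open Container C renaming (Sh to S; Po to P)
    open ICMSOps O
    open Extent C
    open Canonical O

    •-unitʳ : ∀ i (s : S i) → s • eᴾ s ≡ s
    •-unitʳ i s = cong proj₁ (unitʳ (P i s) i (generic s))

    ↖-unitʳ : ∀ i (s : S i) j (p : P i (s • eᴾ s) j) → ↖ i s (eᴾ s) j p ≅ p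
    ↖-unitʳ i s j p = begin
      ↖ i s (eᴾ s) j p
        ≅⟨ H.≡-subst-removable (P i s) (Pe≡ (↗ i s (eᴾ s) j p)) _ ⟨
      subst (P i s) (Pe≡ (↗ i s (eᴾ s) j p)) (↖ i s (eᴾ s) j p)
        ≡⟨ ⟦⟧-≡-positions (unitʳ (P i s) i (generic s)) (•-unitʳ i s) j p ⟩
      subst (λ t → P i t j) (•-unitʳ i s) p
        ≅⟨ H.≡-subst-removable (λ t → P i t j) (•-unitʳ i s) p ⟩
      p ∎
      where open ≅-Reasoning

    •-unitˡ : ∀ i (s : S i) → e i • bar s ≡ s
    •-unitˡ i s = begin
      e i • bar s       ≡⟨ cong (e i •_) (η-shapes≡bar s) ⟨
      e i • η-shapes s  ≡⟨ cong proj₁ (unitˡ (P i s) i (generic s)) ⟩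
      s                 ∎
      where open ≡-Reasoning

    ↗-unitˡ : ∀ i (s : S i) j (p : P i (e i • bar s) j) → ↗ i (e i) (bar s) j p ≅ p
    ↗-unitˡ i s j p = begin
      ↗ i (e i) (bar s) j p
        ≅⟨ ↗-cong (sym (η-shapes≡bar s)) p≅p₁ ⟩
      ↗ i (e i) (η-shapes s) j p₁
        ≅⟨ proj₂-subst-generic (Pe≡ (↖ i (e i) (η-shapes s) j p₁)) s j _ ⟨
      proj₂ (μ (P i s) i (η (T (P i s)) i (generic s))) j p₁
        ≡⟨ ⟦⟧-≡-positions (unitˡ (P i s) i (generic s)) shape j p₁ ⟩
      subst (λ t → P i t j) shape p₁
        ≅⟨ H.≡-subst-removable (λ t → P i t j) shape p₁ ⟩
      p₁
        ≅⟨ p≅p₁ ⟨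
      p ∎
      where
        open ≅-Reasoning
        shape : e i • η-shapes s ≡ s
        shape = cong proj₁ (unitˡ (P i s) i (generic s))
        p₁ : P i (e i • η-shapes s) j
        p₁ = subst (λ t → P i (e i • t) j) (sym (η-shapes≡bar s)) p
        p≅p₁ : p ≅ p₁
        p≅p₁ = H.sym (H.≡-subst-removable (λ t → P i (e i • t) j) (sym (η-shapes≡bar s)) p)

    •-assoc : ∀ i (s : S i) (s' : Hom (P i s) S)
              (s'' : (k : I) (q : P i s k) → Hom (P k (s' k q)) S) →
              (s • s') • hat s s' s'' ≡ s • (s' •ᴾ s'')
    •-assoc i s s' s'' = cong proj₁ (assoc _ i (generic³ s s' s''))

    assoc-positions : ∀ i (s : S i) (s' : Hom (P i s) S)
                      (s'' : (k : I) (q : P i s k) → Hom (P k (s' k q)) S)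
                      j (p : P i ((s • s') • hat s s' s'') j) →
                      proj₂ (μ _ i (μ _ i (generic³ s s' s''))) j p
                        ≡ proj₂ (μ _ i (T₁ (μ _) i (generic³ s s' s'')))
                                j (subst (λ t → P i t j) (•-assoc i s s' s'') p)
    assoc-positions i s s' s'' =
      ⟦⟧-≡-positions (assoc _ i (generic³ s s' s'')) (•-assoc i s s' s'')

    laws : ICMSLaws O
    laws = record
      { •-unitʳ  = •-unitʳ
      ; ↖-unitʳ  = ↖-unitʳ
      ; •-unitˡ  = •-unitˡ
      ; ↗-unitˡ  = ↗-unitˡ
      ; •-assoc  = •-assoc
      ; ↑-assoc₁ = λ i s s' s'' j p →
          proj₁ (proj₂ (proj₂ (positions³-injective (assoc-positions i s s' s'' j p))))
      ; ↑-assoc₂ = λ i s s' s'' j p →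
          proj₁ (positions³-injective (assoc-positions i s s' s'' j p))
      ; ↖-assoc  = λ i s s' s'' j p →
          proj₁ (proj₂ (positions³-injective (assoc-positions i s s' s'' j p)))
      ; ↗↖-assoc = λ i s s' s'' j p →
          proj₁ (proj₂ (proj₂ (proj₂ (positions³-injective (assoc-positions i s s' s'' j p)))))
      ; ↗-assoc  = λ i s s' s'' j p →
          proj₂ (proj₂ (proj₂ (proj₂ (positions³-injective (assoc-positions i s s' s'' j p))))) }

  module MonadLawsFromICMSLaws {C : Container I} (O : ICMSOps C) (L : ICMSLaws O) where
    open Container C renaming (Sh to S; Po to P)
    open ICMSOps O
    open ICMSLaws L
    open Extent C
    open Canonical O

    unitʳ : UnitʳLaw
    unitʳ = natural-≡-id (λ X i x → μ X i (T₁ (η X) i x)) natural fixes-generic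
      where
        natural : Natural (λ X i x → μ X i (T₁ (η X) i x))
        natural f i (s , g) = cong (λ h → μ _ i (s , h)) (ext λ j → ext λ p → η-natural f j (g j p))
        fixes-generic : ∀ i s → μ (P i s) i (T₁ (η (P i s)) i (generic s)) ≡ generic s
        fixes-generic i s = ⟦⟧-≡ (•-unitʳ i s) λ j p → H.≅-to-≡ (begin
          subst (P i s) (Pe≡ (↗ i s (eᴾ s) j p)) (↖ i s (eᴾ s) j p)
            ≅⟨ H.≡-subst-removable (P i s) (Pe≡ (↗ i s (eᴾ s) j p)) _ ⟩
          ↖ i s (eᴾ s) j p
            ≅⟨ ↖-unitʳ i s j p ⟩
          p
            ≅⟨ H.≡-subst-removable (λ t → P i t j) (•-unitʳ i s) p ⟨
          subst (λ t → P i t j) (•-unitʳ i s) p ∎)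
          where open ≅-Reasoning

    unitˡ : UnitˡLaw
    unitˡ = natural-≡-id (λ X i x → μ X i (η (T X) i x))
                         (λ f i x → cong (μ _ i) (η-natural (T₁ f) i x)) fixes-generic
      where
        fixes-generic : ∀ i s → μ (P i s) i (η (T (P i s)) i (generic s)) ≡ generic s
        fixes-generic i s = ⟦⟧-≡ shape positions
          where
            shape : e i • η-shapes s ≡ s
            shape = trans (cong (e i •_) (η-shapes≡bar s)) (•-unitˡ i s)
            positions : ∀ j (p : P i (e i • η-shapes s) j) →
                        proj₂ (μ (P i s) i (η (T (P i s)) i (generic s))) j p
                          ≡ subst (λ t → P i t j) shape p
            positions j p = H.≅-to-≡ (begin
              proj₂ (μ (P i s) i (η (T (P i s)) i (generic s))) j p
                ≅⟨ proj₂-subst-generic (Pe≡ (↖ i (e i) (η-shapes s) j p)) s j _ ⟩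
              ↗ i (e i) (η-shapes s) j p
                ≅⟨ ↗-cong (η-shapes≡bar s) (H.sym p₁≅p) ⟩
              ↗ i (e i) (bar s) j p₁
                ≅⟨ ↗-unitˡ i s j p₁ ⟩
              p₁
                ≅⟨ p₁≅p ⟩
              p
                ≅⟨ H.≡-subst-removable (λ t → P i t j) shape p ⟨
              subst (λ t → P i t j) shape p ∎)
              where
                open ≅-Reasoning
                p₁ : P i (e i • bar s) j
                p₁ = subst (λ t → P i (e i • t) j) (η-shapes≡bar s) p
                p₁≅p : p₁ ≅ p
                p₁≅p = H.≡-subst-removable (λ t → P i (e i • t) j) (η-shapes≡bar s) p

    assoc-generic : ∀ i (s : S i) (s' : Hom (P i s) S)
                    (s'' : (k : I) (q : P i s k) → Hom (P k (s' k q)) S) →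
                    μ _ i (μ _ i (generic³ s s' s'')) ≡ μ _ i (T₁ (μ _) i (generic³ s s' s''))
    assoc-generic i s s' s'' = ⟦⟧-≡ (•-assoc i s s' s'') λ j p →
      positions³-≡ (↑-assoc₂ i s s' s'' j p) (↖-assoc i s s' s'' j p) (↑-assoc₁ i s s' s'' j p)
                   (↗↖-assoc i s s' s'' j p) (↗-assoc i s s' s'' j p)

    -- μ only relabels positions, so both sides at x are, definitionally, the
    -- relabelled sides at the generic element.
    assoc : AssocLaw
    assoc X i x = cong (T₁ relabel i) (assoc-generic i s s' s'')
      where
        s : S i
        s = proj₁ x
        s' : Hom (P i s) S
        s' k q = proj₁ (proj₂ x k q)
        s'' : (k : I) (q : P i s k) → Hom (P k (s' k q)) S
        s'' k q l r = proj₁ (proj₂ (proj₂ x k q) l r)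
        relabel : Hom (Positions³ i s s' s'') X
        relabel j (k , q , l , r , t) = proj₂ (proj₂ (proj₂ x k q) l r) j t

  module Morphisms (A B : ICMSObj {I}) where
    open ICMSObj A renaming (cont to C; icms to MA)
    open ICMSObj B renaming (cont to C'; icms to MB)
    open Container C renaming (Sh to S; Po to P)
    open Container C' renaming (Sh to S'; Po to P')
    open ICMS MA
    open ICMS MB using () renaming (e to e'; _•_ to _•'_)
    module CA = Canonical (ICMS.ops MA)
    module CB = Canonical (ICMS.ops MB)
    open Extent C using (Positions²; generic²; positions²-≡; positions²-injective)
    open Extent C' using (⟦⟧-≡; ⟦⟧-≡-positions)

    module _ (σ : (i : I) → S i → S' i) (π : (i : I) (s : S i) → Hom (P' i (σ i s)) (P i s)) where

      extentMor : (X : I → Set) → Hom (⟦ C ⟧ X) (⟦ C' ⟧ X)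
      extentMor X i (s , f) = σ i s , λ j q → f j (π i s j q)

      αμ μαα : (X : I → Set) → Hom (⟦ C ⟧ (⟦ C ⟧ X)) (⟦ C' ⟧ X)
      αμ X i x = extentMor X i (CA.μ X i x)
      μαα X i x = CB.μ X i (extentMor (⟦ C' ⟧ X) i (⟦ C ⟧₁ (extentMor X) i x))

      PreservesUnit PreservesMult : Set₁
      PreservesUnit = ∀ X i (x : X i) → extentMor X i (CA.η X i x) ≡ CB.η X i x
      PreservesMult = ∀ X i (x : ⟦ C ⟧ (⟦ C ⟧ X) i) → μαα X i x ≡ αμ X i x

      -- Pe≡ takes values in i ≡ j, so by UIP only the shape of the unit matters.
      preservesUnit : (∀ i → σ i (e i) ≡ e' i) → PreservesUnit
      preservesUnit σ-e X i x = ⟦⟧-≡ (σ-e i) λ j q → cong (λ eq → subst X eq x) (uip _ _)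

      preservesMult : (∀ i s v → μαα _ i (generic² s v) ≡ αμ _ i (generic² s v)) → PreservesMult
      preservesMult generic X i x = cong (⟦ C' ⟧₁ relabel i) (generic i s v)
        where
          s : S i
          s = proj₁ x
          v : Hom (P i s) S
          v k q = proj₁ (proj₂ x k q)
          relabel : Hom (Positions² i s v) X
          relabel j (k , q , r) = proj₂ (proj₂ x k q) j r

    icmsMor⇒preservesMult : (f : ICMSMor A B) → PreservesMult (ICMSMor.σ f) (ICMSMor.π f)
    icmsMor⇒preservesMult f = preservesMult σ π λ i s v → sym (⟦⟧-≡ (sym (σ-• i s v)) λ j p →
      positions²-≡ (sym (π-↑ i s v j p)) (H.sym (π-↖ i s v j p)) (H.sym (π-↗ i s v j p)))
      where open ICMSMor f

    preserving⇒icmsMor : (σ : (i : I) → S i → S' i)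
                         (π : (i : I) (s : S i) → Hom (P' i (σ i s)) (P i s)) →
                         PreservesUnit σ π → PreservesMult σ π → ICMSMor A B
    preserving⇒icmsMor σ π unit mult = record
      { σ   = σ
      ; π   = π
      ; σ-e = λ i → cong proj₁ (unit (i ≡_) i refl)
      ; π-e = λ i j q → uip _ _
      ; σ-• = σ-•
      ; π-↑ = λ i s v j p → sym (proj₁ (positions²-injective (positions i s v j p)))
      ; π-↖ = λ i s v j p → H.sym (proj₁ (proj₂ (positions²-injective (positions i s v j p))))
      ; π-↗ = λ i s v j p → H.sym (proj₂ (proj₂ (positions²-injective (positions i s v j p)))) }
      where
        σ-• : ∀ i (s : S i) (v : Hom (P i s) S) → σ i s •' (⟨ C , C' ⟩ π i s ⨾ v ⨾ σ) ≡ σ i (s • v)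
        σ-• i s v = cong proj₁ (mult _ i (generic² s v))
        positions : ∀ i (s : S i) (v : Hom (P i s) S) j (p : P' i (σ i (s • v)) j) →
                    proj₂ (αμ σ π _ i (generic² s v)) j p
                      ≡ proj₂ (μαα σ π _ i (generic² s v))
                              j (subst (λ t → P' i t j) (sym (σ-• i s v)) p)
        positions i s v = ⟦⟧-≡-positions (sym (mult _ i (generic² s v))) (sym (σ-• i s v))

  module FromMonad (M : ContainerMonad {I}) where
    open ContainerMonad M
    open Container cont renaming (Sh to S; Po to P)
    open Extent cont

    ops : ICMSOps cont
    ops = record
      { e   = λ i → proj₁ (η (i ≡_) i refl)
      ; _•_ = λ {i} s s' → proj₁ (μ _ i (generic² s s'))
      ; Pe≡ = λ {i} {j} → proj₂ (η (i ≡_) i refl) j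
      ; ↑   = λ i s s' j p → proj₁ (proj₂ (μ _ i (generic² s s')) j p)
      ; ↖   = λ i s s' j p → proj₁ (proj₂ (proj₂ (μ _ i (generic² s s')) j p))
      ; ↗   = λ i s s' j p → proj₂ (proj₂ (proj₂ (μ _ i (generic² s s')) j p)) }

    module Canon = Canonical ops

    η-canonical : ∀ X i (x : X i) → η X i x ≡ Canon.η X i x
    η-canonical X i x = η-natural (λ j eq → subst X eq x) i refl

    μ-canonical : ∀ X i (x : T (T X) i) → μ X i x ≡ Canon.μ X i x
    μ-canonical X i (s , f) = μ-natural relabel i (generic² s (λ k q → proj₁ (f k q)))
      where
        relabel : Hom (Positions² i s (λ k q → proj₁ (f k q))) X
        relabel j (k , q , r) = proj₂ (f k q) j r

    open ≡-Reasoning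

    unitˡ-canonical : Canon.UnitˡLaw
    unitˡ-canonical X i x = begin
      Canon.μ X i (Canon.η (T X) i x)  ≡⟨ μ-canonical X i _ ⟨
      μ X i (Canon.η (T X) i x)        ≡⟨ cong (μ X i) (η-canonical (T X) i x) ⟨
      μ X i (η (T X) i x)              ≡⟨ unitˡ X i x ⟩
      x                                ∎

    unitʳ-canonical : Canon.UnitʳLaw
    unitʳ-canonical X i x = begin
      Canon.μ X i (T₁ (Canon.η X) i x)  ≡⟨ μ-canonical X i _ ⟨
      μ X i (T₁ (Canon.η X) i x)        ≡⟨ cong (μ X i) (⟦⟧₁-cong (η-canonical X) x) ⟨
      μ X i (T₁ (η X) i x)              ≡⟨ unitʳ X i x ⟩
      x                                 ∎

    assoc-canonical : Canon.AssocLaw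
    assoc-canonical X i x = begin
      Canon.μ X i (Canon.μ (T X) i x)   ≡⟨ μ-canonical X i _ ⟨
      μ X i (Canon.μ (T X) i x)         ≡⟨ cong (μ X i) (μ-canonical (T X) i x) ⟨
      μ X i (μ (T X) i x)               ≡⟨ assoc X i x ⟩
      μ X i (T₁ (μ X) i x)              ≡⟨ cong (μ X i) (⟦⟧₁-cong (μ-canonical X) x) ⟩
      μ X i (T₁ (Canon.μ X) i x)        ≡⟨ μ-canonical X i _ ⟩
      Canon.μ X i (T₁ (Canon.μ X) i x)  ∎

    obj : ICMSObj {I}
    obj = cont ,ᵢ record
      { ops  = ops
      ; laws = ICMSLawsFromMonadLaws.laws ops unitˡ-canonical unitʳ-canonical assoc-canonical }

  module FromMonadMorphism {M N : ContainerMonad {I}} (f : MonadMor M N) where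
    private
      module M = ContainerMonad M
      module N = ContainerMonad N
      module FM = FromMonad M
      module FN = FromMonad N
    open MonadMor f
    open Container M.cont renaming (Sh to S; Po to P)
    open Container N.cont renaming (Sh to S'; Po to P')
    open Morphisms FM.obj FN.obj

    σ : (i : I) → S i → S' i
    σ i s = proj₁ (α (P i s) i (Extent.generic M.cont s))

    π : (i : I) (s : S i) → Hom (P' i (σ i s)) (P i s)
    π i s = proj₂ (α (P i s) i (Extent.generic M.cont s))

    α-canonical : ∀ X i (x : M.T X i) → α X i x ≡ extentMor σ π X i x
    α-canonical X i (s , g) = α-natural g i (Extent.generic M.cont s)

    open ≡-Reasoning

    unit : PreservesUnit σ π
    unit X i x = begin
      extentMor σ π X i (FM.Canon.η X i x)  ≡⟨ α-canonical X i _ ⟨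
      α X i (FM.Canon.η X i x)              ≡⟨ cong (α X i) (FM.η-canonical X i x) ⟨
      α X i (M.η X i x)                     ≡⟨ α-η X i x ⟩
      N.η X i x                             ≡⟨ FN.η-canonical X i x ⟩
      FN.Canon.η X i x                      ∎

    mult : PreservesMult σ π
    mult X i x = begin
      μαα σ π X i x
        ≡⟨ FN.μ-canonical X i _ ⟨
      N.μ X i (extentMor σ π (N.T X) i (M.T₁ (extentMor σ π X) i x))
        ≡⟨ cong (N.μ X i) (α-canonical (N.T X) i _) ⟨
      N.μ X i (α (N.T X) i (M.T₁ (extentMor σ π X) i x))
        ≡⟨ cong (λ y → N.μ X i (α (N.T X) i y)) (Extent.⟦⟧₁-cong M.cont (α-canonical X) x) ⟨
      N.μ X i (α (N.T X) i (M.T₁ (α X) i x))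
        ≡⟨ α-μ X i x ⟩
      α X i (M.μ X i x)
        ≡⟨ α-canonical X i _ ⟩
      extentMor σ π X i (M.μ X i x)
        ≡⟨ cong (extentMor σ π X i) (FM.μ-canonical X i x) ⟩
      αμ σ π X i x
        ∎

    mor : ICMSMor FM.obj FN.obj
    mor = preserving⇒icmsMor σ π unit mult

  toMonad : ICMSObj {I} → ContainerMonad {I}
  toMonad (C ,ᵢ M) = record
    { cont = C ; η = η ; μ = μ
    ; η-natural = η-natural ; μ-natural = λ f i x → refl
    ; unitˡ = unitˡ ; unitʳ = unitʳ ; assoc = assoc }
    where
      open Canonical (ICMS.ops M)
      open MonadLawsFromICMSLaws (ICMS.ops M) (ICMS.laws M)

  toMonadMor : {A B : ICMSObj {I}} → ICMSMor A B → MonadMor (toMonad A) (toMonad B)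
  toMonadMor {A} {B} f = record
    { α = extentMor σ π ; α-natural = λ g i x → refl
    ; α-η = preservesUnit σ π σ-e ; α-μ = icmsMor⇒preservesMult f }
    where
      open Morphisms A B
      open ICMSMor f

  ≈ᵢ-from-generic : {A B : ICMSObj {I}} (f g : ICMSMor A B) →
                    (∀ i s → _≡_ {A = ⟦ ICMSObj.cont B ⟧ (Container.Po (ICMSObj.cont A) i s) i}
                                 (ICMSMor.σ f i s , ICMSMor.π f i s)
                                 (ICMSMor.σ g i s , ICMSMor.π g i s)) →
                    f ≈ᵢ g
  ≈ᵢ-from-generic {B = B} _ _ eq =
    (λ i s → cong proj₁ (eq i s)) , λ i s → Extent.⟦⟧-≡-positions-≅ (ICMSObj.cont B) (eq i s)

  fromMonadFunctor : Functor (Mnd-Cat {I}) (ICMS-Cat {I})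
  fromMonadFunctor = record
    { F₀ = FromMonad.obj
    ; F₁ = FromMonadMorphism.mor
    ; identity = λ {M} → ≈ᵢ-from-generic (mor (idₘ {M = M})) idᵢ λ i s → refl
    ; homomorphism = λ {L} {_} {_} {f} {g} → ≈ᵢ-from-generic (mor (g ∘ₘ f)) (mor g ∘ᵢ mor f) λ i s →
        α-canonical g _ i (MonadMor.α f _ i (Extent.generic (ContainerMonad.cont L) s))
    ; F-resp-≈ = λ {M} {_} {f} {g} f≈g → ≈ᵢ-from-generic (mor f) (mor g) λ i s →
        f≈g _ i (Extent.generic (ContainerMonad.cont M) s) }
    where open FromMonadMorphism using (mor; α-canonical)

  toMonadFunctor : Functor (ICMS-Cat {I}) (Mnd-Cat {I})
  toMonadFunctor = record
    { F₀ = toMonad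
    ; F₁ = toMonadMor
    ; identity = λ X i x → refl
    ; homomorphism = λ X i x → refl
    ; F-resp-≈ = λ {_} {B} (σ≡ , π≡) X i (s , h) → Extent.⟦⟧-≡ (ICMSObj.cont B) (σ≡ i s) λ j q →
        cong (h j) (π≡ i s j q _ (H.sym (H.≡-subst-removable _ (σ≡ i s) q))) }

  unitIso : NaturalIsomorphism idF (toMonadFunctor ∘F fromMonadFunctor)
  unitIso = record
    { ⇒η = λ M → record
        { α = λ X i x → x ; α-natural = λ f i x → refl
        ; α-η = FromMonad.η-canonical M ; α-μ = λ X i x → sym (FromMonad.μ-canonical M X i x) }
    ; ⇐η = λ M → record
        { α = λ X i x → x ; α-natural = λ f i x → refl
        ; α-η = λ X i x → sym (FromMonad.η-canonical M X i x) ; α-μ = FromMonad.μ-canonical M }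
    ; commute = FromMonadMorphism.α-canonical
    ; isoˡ = λ M X i x → refl
    ; isoʳ = λ M X i x → refl }

  -- The round trip only turns Pe≡ q into subst (i ≡_) (Pe≡ q) refl, so the identity maps are
  -- ICMS morphisms by UIP.
  counitIso : NaturalIsomorphism (fromMonadFunctor ∘F toMonadFunctor) idF
  counitIso = record
    { ⇒η = to
    ; ⇐η = from
    ; commute = λ {A} {B} f → ≈ᵢ-from-generic (to B ∘ᵢ F₁ f) (f ∘ᵢ to A) λ i s → refl
    ; isoˡ = λ A → ≈ᵢ-from-generic (from A ∘ᵢ to A) idᵢ λ i s → refl
    ; isoʳ = λ A → ≈ᵢ-from-generic (to A ∘ᵢ from A) idᵢ λ i s → refl }
    where
      open Functor (fromMonadFunctor ∘F toMonadFunctor) using (F₀; F₁)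
      to : (A : ICMSObj {I}) → ICMSMor (F₀ A) A
      to A = preserving⇒icmsMor (λ i s → s) (λ i s j q → q)
                     (preservesUnit (λ i s → s) (λ i s j q → q) λ i → refl) λ X i x → refl
        where open Morphisms (F₀ A) A
      from : (A : ICMSObj {I}) → ICMSMor A (F₀ A)
      from A = preserving⇒icmsMor (λ i s → s) (λ i s j q → q)
                       (preservesUnit (λ i s → s) (λ i s j q → q) λ i → refl) λ X i x → refl
        where open Morphisms A (F₀ A)

  equivalence : Equivalence (Mnd-Cat {I}) (ICMS-Cat {I})
  equivalence = record
    { F = fromMonadFunctor ; G = toMonadFunctor ; unit = unitIso ; counit = counitIso }

theorem3p10 : (I : Set) → Extensionality 0ℓ 0ℓ →
    Equivalence (Mnd-Cat {I}) (ICMS-Cat {I})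
theorem3p10 I ext = equivalence {I} ext
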